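{- Let $p,q\geq 1$ and $r>q+1$ be integers. Then \[ \zeta_{H^{(p,q+1)}}(r)=\frac{1}{q!}\sum_{m=0}^{q}\sum_{k=0}^{m}(-1)^{k}\genfrac{[}{]}{0pt}{}{q+1}{m+1}\binom{m}{k}\,\zeta_{H^{(p-k)}}(r+k-m). \]
   Context: For $p\in\mathbb{Z}$ and $n\geq1$, $H_n^{(p)}=\sum_{j=1}^{n}j^{ -p}$. The generalized hyperharmonic numbers are defined by $H_n^{(p,0)}=1/n^{p}$ and $H_n^{(p,r)}=\sum_{k=1}^{n}H_k^{(p,r-1)}$ for $r\geq1$. Euler sums: $\zeta_{H^{(p)}}(s)=\sum_{n=1}^{\infty}H_n^{(p)}/n^{s}$ and $\zeta_{H^{(p,q)}}(s)=\sum_{n=1}^{\infty}H_n^{(p,q)}/n^{s}$. $\genfrac{[}{]}{0pt}{}{n}{k}$ denotes the (unsigned) Stirling number of the first kind, defined by $x(x+1)\cdots(x+n-1)=\sum_{k=0}^{n}\genfrac{[}{]}{0pt}{}{n}{k}x^{k}$. -}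

module Defs where

open import Data.Nat as ℕ using (ℕ; zero; suc; _^_; _!)
open import Data.Nat.Properties using (m^n≢0; _!≢0)
open import Data.Nat.Combinatorics using (_C_)
open import Data.Integer as ℤ using (ℤ; +_; -[1+_])
open import Data.Rational as ℚ using (ℚ; 0ℚ; 1ℚ; _+_; _*_; _-_; -_; ∣_∣; _<_; _/_)
open import Data.Product using (Σ; _×_)

sum1 : ℕ → (ℕ → ℚ) → ℚ
sum1 zero    f = 0ℚ
sum1 (suc n) f = sum1 n f + f (suc n)

sum0 : ℕ → (ℕ → ℚ) → ℚ
sum0 zero    f = f 0
sum0 (suc n) f = sum0 n f + f (suc n)

ℕ→ℚ : ℕ → ℚ
ℕ→ℚ n = (+ n) / 1

-- j ^ (- e) for an integer exponent e and j ≥ 1 (value at j = 0 is irrelevant, set to 0)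
invPow : ℤ → ℕ → ℚ
invPow e zero = 0ℚ
invPow (+ e) (suc i) = _/_ (+ 1) (suc i ^ e) {{m^n≢0 (suc i) e}}
invPow -[1+ e ] (suc i) = ℕ→ℚ (suc i ^ suc e)

H : ℤ → ℕ → ℚ
H p n = sum1 n (invPow p)

HH : ℕ → ℕ → ℕ → ℚ
HH p zero    n = invPow (+ p) n
HH p (suc r) n = sum1 n (HH p r)

stirling : ℕ → ℕ → ℕ
stirling zero    zero    = 1
stirling zero    (suc k) = 0
stirling (suc n) zero    = 0
stirling (suc n) (suc k) = n ℕ.* stirling n (suc k) ℕ.+ stirling n k

zetaPartial : (ℕ → ℚ) → ℕ → ℕ → ℚ
zetaPartial a s N = sum1 N (λ n → a n * invPow (+ s) n)

sign : ℕ → ℚ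
sign zero = 1ℚ
sign (suc k) = - sign k

-- a rational sequence is Cauchy (i.e. the real series/sequence converges)
Cauchy : (ℕ → ℚ) → Set
Cauchy f = ∀ (ε : ℚ) → 0ℚ < ε → Σ ℕ λ N → ∀ m n → N ℕ.≤ m → N ℕ.≤ n → ∣ f m - f n ∣ < ε

SameLimit : (ℕ → ℚ) → (ℕ → ℚ) → Set
SameLimit f g = ∀ (ε : ℚ) → 0ℚ < ε → Σ ℕ λ N → ∀ n → N ℕ.≤ n → ∣ f n - g n ∣ < ε

zetaHHPartial : ℕ → ℕ → ℕ → ℕ → ℚ
zetaHHPartial p q s = zetaPartial (HH p q) s

zetaHPartial : ℤ → ℕ → ℕ → ℚ
zetaHPartial p s = zetaPartial (H p) s

rhsPartial : ℕ → ℕ → ℕ → ℕ → ℚ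
rhsPartial p q r N =
  (_/_ (+ 1) (q !) {{q !≢0}}) *
  sum0 q (λ m → sum0 m (λ k →
    sign k * ℕ→ℚ (stirling (suc q) (suc m) ℕ.* (m C k)) *
    zetaHPartial (+ p ℤ.- + k) (r ℕ.+ k ℕ.∸ m) N))

-- Summing q + 1 times gives Cauchy's formula
--   q! H_n^(p,q+1) = Σ_{j=1}^{n} (n-j+1)(n-j+2)⋯(n-j+q) j^(-p).
-- Expanding (y+1)⋯(y+q) = Σ_m [q+1, m+1] y^m and then (n-j)^m by the binomial theorem
-- writes H_n^(p,q+1) n^(-r) as a fixed finite combination of the terms H_n^(p-k) n^(-(r+k-m)),
-- so the partial sums of the two sides agree for every N.  Each series converges by
-- comparison: its terms are at most n^t H_n n^(-(t+2)) = H_n / n^2, and the tail of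
-- Σ H_n / n^2 beyond n is at most (H_n + 1) / n, which tends to 0 because H_N ≤ K + N / (K+1).
module Submission where

open import Defs

module EulerSums where
  open import Algebra.Bundles using (CommutativeRing; CommutativeMonoid)
  open import Data.Fin using (toℕ)
  open import Data.Integer as ℤ using (+_; -[1+_])
  import Data.Integer.Properties as ℤₚ
  open import Data.Nat as ℕ using (ℕ; zero; suc; z≤n; s≤s; _!)
  open import Data.Nat.Combinatorics using (_C_)
  open import Data.Nat.Coprimality using (1-coprimeTo) renaming (sym to coprime-sym)
  import Data.Nat.Properties as ℕₚ
  open import Data.Rational as ℚ using (ℚ; mkℚ; 0ℚ; 1ℚ; _+_; _*_; _-_; -_; _/_; 1/_; _≤_; _<_; ∣_∣)
  open import Data.Rational.Properties
  open import Data.Rational.Solver using (module +-*-Solver)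
  open import Relation.Binary.PropositionalEquality
  open import Relation.Nullary using (yes; no)
  open import Data.Product using (Σ; _,_)
  open import Data.Sum using (inj₁; inj₂)
  open CommutativeRing +-*-commutativeRing using (semiring; commutativeSemiring)
  open import Algebra.Definitions.RawMonoid +-rawMonoid using (_×_)
  open import Algebra.Properties.Semiring.Exp semiring using (_^_; ^-homo-*)
  open import Algebra.Properties.CommutativeSemiring.Exp commutativeSemiring using (^-distrib-*)
  open import Algebra.Properties.Semiring.Sum semiring using (sum⁺-syntax; sum-cong-≗)
  import Algebra.Properties.CommutativeSemiring.Binomial commutativeSemiring as Binomial
  open import Algebra.Properties.CommutativeSemigroup (CommutativeMonoid.commutativeSemigroup +-0-commutativeMonoid)
    using () renaming (interchange to +-interchange)
  open +-*-Solver using (solve; _:+_; _:*_; _:-_; :-_; _:=_; con)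

  ℕ→ℚ≡mkℚ : ∀ n → ℕ→ℚ n ≡ mkℚ (+ n) 0 (coprime-sym (1-coprimeTo n))
  ℕ→ℚ≡mkℚ n = ↥p/↧p≡p (mkℚ (+ n) 0 (coprime-sym (1-coprimeTo n)))

  ℕ→ℚ-homo-+ : ∀ m n → ℕ→ℚ (m ℕ.+ n) ≡ ℕ→ℚ m + ℕ→ℚ n
  ℕ→ℚ-homo-+ m n = sym (begin
    ℕ→ℚ m + ℕ→ℚ n                  ≡⟨ cong₂ _+_ (ℕ→ℚ≡mkℚ m) (ℕ→ℚ≡mkℚ n) ⟩
    (+ m ℤ.* + 1 ℤ.+ + n ℤ.* + 1) / 1 ≡⟨ /-cong (cong₂ ℤ._+_ (ℤₚ.*-identityʳ (+ m)) (ℤₚ.*-identityʳ (+ n))) refl ⟩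
    ℕ→ℚ (m ℕ.+ n)                  ∎)
    where open ≡-Reasoning

  ℕ→ℚ-homo-* : ∀ m n → ℕ→ℚ (m ℕ.* n) ≡ ℕ→ℚ m * ℕ→ℚ n
  ℕ→ℚ-homo-* m n = sym (begin
    ℕ→ℚ m * ℕ→ℚ n        ≡⟨ cong₂ _*_ (ℕ→ℚ≡mkℚ m) (ℕ→ℚ≡mkℚ n) ⟩
    (+ m ℤ.* + n) / 1      ≡⟨ /-cong (sym (ℤₚ.pos-* m n)) refl ⟩
    ℕ→ℚ (m ℕ.* n)        ∎)
    where open ≡-Reasoning

  ℕ→ℚ-suc : ∀ n → ℕ→ℚ (suc n) ≡ 1ℚ + ℕ→ℚ n
  ℕ→ℚ-suc = ℕ→ℚ-homo-+ 1

  ℕ→ℚ-homo-^ : ∀ m e → ℕ→ℚ (m ℕ.^ e) ≡ ℕ→ℚ m ^ e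
  ℕ→ℚ-homo-^ m zero    = refl
  ℕ→ℚ-homo-^ m (suc e) = trans (ℕ→ℚ-homo-* m (m ℕ.^ e)) (cong (ℕ→ℚ m *_) (ℕ→ℚ-homo-^ m e))

  ×≡ℕ→ℚ* : ∀ n x → n × x ≡ ℕ→ℚ n * x
  ×≡ℕ→ℚ* zero    x = sym (*-zeroˡ x)
  ×≡ℕ→ℚ* (suc n) x = begin
    x + n × x              ≡⟨ cong (_+_ x) (×≡ℕ→ℚ* n x) ⟩
    x + ℕ→ℚ n * x          ≡⟨ solve 2 (λ x c → x :+ c :* x := (con 1ℚ :+ c) :* x) refl x (ℕ→ℚ n) ⟩
    (1ℚ + ℕ→ℚ n) * x       ≡⟨ cong (_* x) (sym (ℕ→ℚ-suc n)) ⟩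
    ℕ→ℚ (suc n) * x        ∎
    where open ≡-Reasoning

  1/d*d≡1 : ∀ d .{{_ : ℕ.NonZero d}} → (+ 1 / d) * ℕ→ℚ d ≡ 1ℚ
  1/d*d≡1 (suc k) = begin
    (+ 1 / suc k) * ℕ→ℚ (suc k)    ≡⟨ cong₂ _*_ (↥p/↧p≡p (1/ d)) (ℕ→ℚ≡mkℚ (suc k)) ⟩
    1/ d * d                       ≡⟨ *-inverseˡ d ⟩
    1ℚ                             ∎
    where
      open ≡-Reasoning
      d = mkℚ (+ suc k) 0 (coprime-sym (1-coprimeTo (suc k)))

  *ℕ→ℚ≡1⇒≡1/ : ∀ d .{{_ : ℕ.NonZero d}} x → x * ℕ→ℚ d ≡ 1ℚ → x ≡ + 1 / d
  *ℕ→ℚ≡1⇒≡1/ d x x*d≡1 = begin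
    x                              ≡⟨ sym (*-identityʳ x) ⟩
    x * 1ℚ                         ≡⟨ cong (x *_) (sym (trans (*-comm (ℕ→ℚ d) (+ 1 / d)) (1/d*d≡1 d))) ⟩
    x * (ℕ→ℚ d * (+ 1 / d))        ≡⟨ sym (*-assoc x (ℕ→ℚ d) (+ 1 / d)) ⟩
    (x * ℕ→ℚ d) * (+ 1 / d)        ≡⟨ cong (_* (+ 1 / d)) x*d≡1 ⟩
    1ℚ * (+ 1 / d)                 ≡⟨ *-identityˡ (+ 1 / d) ⟩
    + 1 / d                        ∎
    where open ≡-Reasoning

  recip : ℕ → ℚ
  recip k = + 1 / suc k

  recip*ℕ→ℚ≡1 : ∀ k → recip k * ℕ→ℚ (suc k) ≡ 1ℚ
  recip*ℕ→ℚ≡1 k = 1/d*d≡1 (suc k)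

  recip-sub-recip-suc : ∀ k → recip k - recip (suc k) ≡ recip (suc k) * recip k
  recip-sub-recip-suc k = begin
    v - u                                       ≡⟨ solve 2 (λ v u → v :- u := v :* con 1ℚ :- u :* con 1ℚ) refl v u ⟩
    v * 1ℚ - u * 1ℚ                             ≡⟨ cong₂ (λ x y → v * x - u * y) (sym u*[1+ι]≡1) (sym (recip*ℕ→ℚ≡1 k)) ⟩
    v * (u * (1ℚ + ι)) - u * (v * ι)            ≡⟨ solve 3 (λ v u ι → v :* (u :* (con 1ℚ :+ ι)) :- u :* (v :* ι) := u :* v) refl v u ι ⟩
    u * v                                       ∎
    where
      open ≡-Reasoning
      v = recip k
      u = recip (suc k)
      ι = ℕ→ℚ (suc k)
      u*[1+ι]≡1 : u * (1ℚ + ι) ≡ 1ℚ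
      u*[1+ι]≡1 = trans (cong (u *_) (sym (ℕ→ℚ-suc (suc k)))) (recip*ℕ→ℚ≡1 (suc k))

  recip+recip≡recip : ∀ k → recip (k ℕ.+ suc k) + recip (k ℕ.+ suc k) ≡ recip k
  recip+recip≡recip k = *ℕ→ℚ≡1⇒≡1/ (suc k) (t + t) (begin
    (t + t) * ℕ→ℚ (suc k)                  ≡⟨ solve 2 (λ t c → (t :+ t) :* c := t :* (c :+ c)) refl t (ℕ→ℚ (suc k)) ⟩
    t * (ℕ→ℚ (suc k) + ℕ→ℚ (suc k))        ≡⟨ cong (t *_) (sym (ℕ→ℚ-homo-+ (suc k) (suc k))) ⟩
    t * ℕ→ℚ (suc (k ℕ.+ suc k))            ≡⟨ recip*ℕ→ℚ≡1 (k ℕ.+ suc k) ⟩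
    1ℚ                                     ∎)
    where
      open ≡-Reasoning
      t = recip (k ℕ.+ suc k)

  1^n≡1 : ∀ n → 1ℚ ^ n ≡ 1ℚ
  1^n≡1 zero    = refl
  1^n≡1 (suc n) = trans (*-identityˡ (1ℚ ^ n)) (1^n≡1 n)

  recip^*ℕ→ℚ^≡1 : ∀ k n → recip k ^ n * ℕ→ℚ (suc k) ^ n ≡ 1ℚ
  recip^*ℕ→ℚ^≡1 k n = begin
    recip k ^ n * ℕ→ℚ (suc k) ^ n    ≡⟨ sym (^-distrib-* (recip k) (ℕ→ℚ (suc k)) n) ⟩
    (recip k * ℕ→ℚ (suc k)) ^ n      ≡⟨ cong (_^ n) (recip*ℕ→ℚ≡1 k) ⟩
    1ℚ ^ n                           ≡⟨ 1^n≡1 n ⟩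
    1ℚ                               ∎
    where open ≡-Reasoning

  invPow-+ : ∀ e k → invPow (+ e) (suc k) ≡ recip k ^ e
  invPow-+ e k = sym (*ℕ→ℚ≡1⇒≡1/ (suc k ℕ.^ e) {{ℕₚ.m^n≢0 (suc k) e}} (recip k ^ e)
    (trans (cong (recip k ^ e *_) (ℕ→ℚ-homo-^ (suc k) e)) (recip^*ℕ→ℚ^≡1 k e)))

  invPow-1 : ∀ k → invPow (+ 1) (suc k) ≡ recip k
  invPow-1 k = trans (invPow-+ 1 k) (*-identityʳ (recip k))

  invPow-2 : ∀ k → invPow (+ 2) (suc k) ≡ recip k * recip k
  invPow-2 k = trans (invPow-+ 2 k) (cong (recip k *_) (*-identityʳ (recip k)))

  invPow-neg : ∀ e k → invPow -[1+ e ] (suc k) ≡ ℕ→ℚ (suc k) ^ suc e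
  invPow-neg e k = ℕ→ℚ-homo-^ (suc k) (suc e)

  invPow-pred : ∀ e k → invPow (ℤ.pred e) (suc k) ≡ invPow e (suc k) * ℕ→ℚ (suc k)
  invPow-pred (+ zero) k = begin
    invPow -[1+ 0 ] (suc k)     ≡⟨ invPow-neg 0 k ⟩
    ℕ→ℚ (suc k) * 1ℚ           ≡⟨ *-comm (ℕ→ℚ (suc k)) 1ℚ ⟩
    1ℚ * ℕ→ℚ (suc k)           ≡⟨ cong (_* ℕ→ℚ (suc k)) (sym (invPow-+ 0 k)) ⟩
    invPow (+ 0) (suc k) * ℕ→ℚ (suc k) ∎
    where open ≡-Reasoning
  invPow-pred (+ suc e) k = begin
    invPow (+ e) (suc k)                      ≡⟨ invPow-+ e k ⟩
    recip k ^ e                               ≡⟨ sym (*-identityʳ (recip k ^ e)) ⟩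
    recip k ^ e * 1ℚ                          ≡⟨ cong (recip k ^ e *_) (sym (recip*ℕ→ℚ≡1 k)) ⟩
    recip k ^ e * (recip k * ℕ→ℚ (suc k))     ≡⟨ solve 3 (λ x r n → x :* (r :* n) := (r :* x) :* n) refl (recip k ^ e) (recip k) (ℕ→ℚ (suc k)) ⟩
    recip k ^ suc e * ℕ→ℚ (suc k)             ≡⟨ cong (_* ℕ→ℚ (suc k)) (sym (invPow-+ (suc e) k)) ⟩
    invPow (+ suc e) (suc k) * ℕ→ℚ (suc k)    ∎
    where open ≡-Reasoning
  invPow-pred -[1+ e ] k = begin
    invPow -[1+ suc e ] (suc k)               ≡⟨ invPow-neg (suc e) k ⟩
    ℕ→ℚ (suc k) * ℕ→ℚ (suc k) ^ suc e         ≡⟨ *-comm (ℕ→ℚ (suc k)) _ ⟩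
    ℕ→ℚ (suc k) ^ suc e * ℕ→ℚ (suc k)         ≡⟨ cong (_* ℕ→ℚ (suc k)) (sym (invPow-neg e k)) ⟩
    invPow -[1+ e ] (suc k) * ℕ→ℚ (suc k)     ∎
    where open ≡-Reasoning

  invPow-minus : ∀ e t k → invPow (e ℤ.- + t) (suc k) ≡ invPow e (suc k) * ℕ→ℚ (suc k) ^ t
  invPow-minus e zero k = begin
    invPow (e ℤ.+ + 0) (suc k)    ≡⟨ cong (λ z → invPow z (suc k)) (ℤₚ.+-identityʳ e) ⟩
    invPow e (suc k)              ≡⟨ sym (*-identityʳ _) ⟩
    invPow e (suc k) * 1ℚ         ∎
    where open ≡-Reasoning
  invPow-minus e (suc t) k = begin
    invPow (e ℤ.- + suc t) (suc k)            ≡⟨ cong (λ z → invPow z (suc k)) (ℤₚ.minus-suc e t) ⟩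
    invPow (ℤ.pred (e ℤ.- + t)) (suc k)       ≡⟨ invPow-pred (e ℤ.- + t) k ⟩
    invPow (e ℤ.- + t) (suc k) * n            ≡⟨ cong (_* n) (invPow-minus e t k) ⟩
    invPow e (suc k) * n ^ t * n              ≡⟨ solve 3 (λ x y n → x :* y :* n := x :* (n :* y)) refl (invPow e (suc k)) (n ^ t) n ⟩
    invPow e (suc k) * n ^ suc t              ∎
    where
      open ≡-Reasoning
      n = ℕ→ℚ (suc k)

  ℕ→ℚ^*invPow : ∀ {t r} j → t ℕ.≤ r → ℕ→ℚ (suc j) ^ t * invPow (+ r) (suc j) ≡ invPow (+ (r ℕ.∸ t)) (suc j)
  ℕ→ℚ^*invPow {t} {r} j t≤r = begin
    ℕ→ℚ (suc j) ^ t * invPow (+ r) (suc j)   ≡⟨ *-comm (ℕ→ℚ (suc j) ^ t) (invPow (+ r) (suc j)) ⟩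
    invPow (+ r) (suc j) * ℕ→ℚ (suc j) ^ t   ≡⟨ sym (invPow-minus (+ r) t j) ⟩
    invPow (+ r ℤ.- + t) (suc j)             ≡⟨ cong (λ z → invPow z (suc j)) (trans (ℤₚ.m-n≡m⊖n r t) (ℤₚ.⊖-≥ t≤r)) ⟩
    invPow (+ (r ℕ.∸ t)) (suc j)             ∎
    where open ≡-Reasoning

  sum1-cong : ∀ n {f g : ℕ → ℚ} → (∀ i → f (suc i) ≡ g (suc i)) → sum1 n f ≡ sum1 n g
  sum1-cong zero    f≗g = refl
  sum1-cong (suc n) f≗g = cong₂ _+_ (sum1-cong n f≗g) (f≗g n)

  sum0-cong : ∀ n {f g : ℕ → ℚ} → (∀ i → i ℕ.≤ n → f i ≡ g i) → sum0 n f ≡ sum0 n g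
  sum0-cong zero    f≗g = f≗g 0 z≤n
  sum0-cong (suc n) f≗g = cong₂ _+_ (sum0-cong n (λ i i≤n → f≗g i (ℕₚ.m≤n⇒m≤1+n i≤n))) (f≗g (suc n) ℕₚ.≤-refl)

  sum1-distrib-+ : ∀ n (f g : ℕ → ℚ) → sum1 n (λ i → f i + g i) ≡ sum1 n f + sum1 n g
  sum1-distrib-+ zero    f g = refl
  sum1-distrib-+ (suc n) f g = trans (cong (_+ (f (suc n) + g (suc n))) (sum1-distrib-+ n f g))
    (+-interchange (sum1 n f) (sum1 n g) (f (suc n)) (g (suc n)))

  sum0-distrib-+ : ∀ n (f g : ℕ → ℚ) → sum0 n (λ i → f i + g i) ≡ sum0 n f + sum0 n g
  sum0-distrib-+ zero    f g = refl
  sum0-distrib-+ (suc n) f g = trans (cong (_+ (f (suc n) + g (suc n))) (sum0-distrib-+ n f g))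
    (+-interchange (sum0 n f) (sum0 n g) (f (suc n)) (g (suc n)))

  *-distribˡ-sum1 : ∀ n c (f : ℕ → ℚ) → c * sum1 n f ≡ sum1 n (λ i → c * f i)
  *-distribˡ-sum1 zero    c f = *-zeroʳ c
  *-distribˡ-sum1 (suc n) c f = trans (*-distribˡ-+ c (sum1 n f) (f (suc n))) (cong (_+ c * f (suc n)) (*-distribˡ-sum1 n c f))

  *-distribʳ-sum1 : ∀ n c (f : ℕ → ℚ) → sum1 n f * c ≡ sum1 n (λ i → f i * c)
  *-distribʳ-sum1 n c f = trans (*-comm (sum1 n f) c) (trans (*-distribˡ-sum1 n c f) (sum1-cong n (λ i → *-comm c (f (suc i)))))

  *-distribˡ-sum0 : ∀ n c (f : ℕ → ℚ) → c * sum0 n f ≡ sum0 n (λ i → c * f i)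
  *-distribˡ-sum0 zero    c f = refl
  *-distribˡ-sum0 (suc n) c f = trans (*-distribˡ-+ c (sum0 n f) (f (suc n))) (cong (_+ c * f (suc n)) (*-distribˡ-sum0 n c f))

  *-distribʳ-sum0 : ∀ n c (f : ℕ → ℚ) → sum0 n f * c ≡ sum0 n (λ i → f i * c)
  *-distribʳ-sum0 n c f = trans (*-comm (sum0 n f) c) (trans (*-distribˡ-sum0 n c f) (sum0-cong n (λ i _ → *-comm c (f i))))

  sum0-zero : ∀ n → sum0 n (λ _ → 0ℚ) ≡ 0ℚ
  sum0-zero zero    = refl
  sum0-zero (suc n) = cong (_+ 0ℚ) (sum0-zero n)

  sum1-sum0-comm : ∀ n m (F : ℕ → ℕ → ℚ) → sum1 n (λ j → sum0 m (F j)) ≡ sum0 m (λ k → sum1 n (λ j → F j k))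
  sum1-sum0-comm zero    m F = sym (sum0-zero m)
  sum1-sum0-comm (suc n) m F = trans (cong (_+ sum0 m (F (suc n))) (sum1-sum0-comm n m F))
    (sym (sum0-distrib-+ m (λ k → sum1 n (λ j → F j k)) (F (suc n))))

  triangleSum : ℕ → (ℕ → ℕ → ℚ) → ℚ
  triangleSum q F = sum0 q (λ m → sum0 m (F m))

  triangleSum-cong : ∀ q {F G : ℕ → ℕ → ℚ} → (∀ m k → m ℕ.≤ q → k ℕ.≤ m → F m k ≡ G m k) → triangleSum q F ≡ triangleSum q G
  triangleSum-cong q F≗G = sum0-cong q (λ m m≤q → sum0-cong m (λ k k≤m → F≗G m k m≤q k≤m))

  *-distribʳ-triangleSum : ∀ q c F → triangleSum q F * c ≡ triangleSum q (λ m k → F m k * c)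
  *-distribʳ-triangleSum q c F = trans (*-distribʳ-sum0 q c (λ m → sum0 m (F m))) (sum0-cong q (λ m _ → *-distribʳ-sum0 m c (F m)))

  sum1-triangleSum-comm : ∀ n q (F : ℕ → ℕ → ℕ → ℚ) →
    sum1 n (λ j → triangleSum q (F j)) ≡ triangleSum q (λ m k → sum1 n (λ j → F j m k))
  sum1-triangleSum-comm n q F = trans (sum1-sum0-comm n q (λ j m → sum0 m (F j m)))
    (sum0-cong q (λ m _ → sum1-sum0-comm n m (λ j → F j m)))

  sum0-suc : ∀ n (f : ℕ → ℚ) → sum0 (suc n) f ≡ f 0 + sum0 n (λ i → f (suc i))
  sum0-suc zero    f = refl
  sum0-suc (suc n) f = trans (cong (_+ f (suc (suc n))) (sum0-suc n f)) (+-assoc (f 0) _ _)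

  sum0≡∑ : ∀ n (f : ℕ → ℚ) → sum0 n f ≡ ∑[ k ≤ n ] f (toℕ k)
  sum0≡∑ zero    f = sym (+-identityʳ (f 0))
  sum0≡∑ (suc n) f = trans (sum0-suc n f) (cong (_+_ (f 0)) (sum0≡∑ n (λ i → f (suc i))))

  binomial : ∀ m x y → (x + y) ^ m ≡ sum0 m (λ k → ℕ→ℚ (m C k) * (x ^ k * y ^ (m ℕ.∸ k)))
  binomial m x y = begin
    (x + y) ^ m                                                   ≡⟨ Binomial.theorem m x y ⟩
    Binomial.binomialExpansion x y m                              ≡⟨ sum-cong-≗ (λ k → ×≡ℕ→ℚ* (m C toℕ k) (Binomial.binomial x y m k)) ⟩
    ∑[ k ≤ m ] (ℕ→ℚ (m C toℕ k) * (x ^ toℕ k * y ^ (m ℕ.∸ toℕ k))) ≡⟨ sym (sum0≡∑ m _) ⟩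
    sum0 m (λ k → ℕ→ℚ (m C k) * (x ^ k * y ^ (m ℕ.∸ k)))         ∎
    where open ≡-Reasoning

  -- Rising factorials and Stirling numbers

  n<k⇒stirling≡0 : ∀ {n k} → n ℕ.< k → stirling n k ≡ 0
  n<k⇒stirling≡0 {zero}  {suc k} _         = refl
  n<k⇒stirling≡0 {suc n} {suc k} (s≤s n<k)
    rewrite n<k⇒stirling≡0 (ℕₚ.m<n⇒m<1+n n<k) | n<k⇒stirling≡0 n<k | ℕₚ.*-zeroʳ n = refl

  rising : ℕ → ℚ → ℚ
  rising zero    y = 1ℚ
  rising (suc q) y = rising q y * (y + ℕ→ℚ (suc q))

  stirlingPoly : ℕ → ℚ → ℚ
  stirlingPoly q y = sum0 q (λ m → ℕ→ℚ (stirling (suc q) (suc m)) * y ^ m)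

  stirlingPoly-suc : ∀ q y → stirlingPoly (suc q) y ≡ stirlingPoly q y * (y + ℕ→ℚ (suc q))
  stirlingPoly-suc q y = begin
    stirlingPoly (suc q) y                                      ≡⟨ sum0-cong (suc q) (λ m _ → recurrence m) ⟩
    sum0 (suc q) (λ m → c * shifted m + unshifted m)            ≡⟨ sum0-distrib-+ (suc q) (λ m → c * shifted m) unshifted ⟩
    sum0 (suc q) (λ m → c * shifted m) + sum0 (suc q) unshifted ≡⟨ cong₂ _+_ (sym (*-distribˡ-sum0 (suc q) c shifted)) (sum0-suc q unshifted) ⟩
    c * (S + shifted (suc q)) + (unshifted 0 + sum0 q (λ m → unshifted (suc m)))
      ≡⟨ cong₂ (λ s t → c * (S + s) + (unshifted 0 + t)) top-vanishes lower-part ⟩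
    c * (S + 0ℚ) + (0ℚ * 1ℚ + y * S)                            ≡⟨ solve 3 (λ c s y → c :* (s :+ con 0ℚ) :+ (con 0ℚ :* con 1ℚ :+ y :* s) := s :* (y :+ c)) refl c S y ⟩
    S * (y + c)                                                 ∎
    where
      open ≡-Reasoning
      c = ℕ→ℚ (suc q)
      S = stirlingPoly q y
      shifted unshifted : ℕ → ℚ
      shifted m = ℕ→ℚ (stirling (suc q) (suc m)) * y ^ m
      unshifted m = ℕ→ℚ (stirling (suc q) m) * y ^ m
      recurrence : ∀ m → ℕ→ℚ (stirling (suc (suc q)) (suc m)) * y ^ m ≡ c * shifted m + unshifted m
      recurrence m = begin
        ℕ→ℚ (suc q ℕ.* s₁ ℕ.+ s₀) * y ^ m     ≡⟨ cong (_* y ^ m) (trans (ℕ→ℚ-homo-+ (suc q ℕ.* s₁) s₀) (cong (_+ ℕ→ℚ s₀) (ℕ→ℚ-homo-* (suc q) s₁))) ⟩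
        (c * ℕ→ℚ s₁ + ℕ→ℚ s₀) * y ^ m        ≡⟨ solve 4 (λ c a b x → (c :* a :+ b) :* x := c :* (a :* x) :+ b :* x) refl c (ℕ→ℚ s₁) (ℕ→ℚ s₀) (y ^ m) ⟩
        c * shifted m + unshifted m           ∎
        where
          s₁ = stirling (suc q) (suc m)
          s₀ = stirling (suc q) m
      lower-part : sum0 q (λ m → unshifted (suc m)) ≡ y * S
      lower-part = trans (sum0-cong q (λ m _ → solve 3 (λ s y x → s :* (y :* x) := y :* (s :* x)) refl (ℕ→ℚ (stirling (suc q) (suc m))) y (y ^ m)))
                         (sym (*-distribˡ-sum0 q y shifted))
      top-vanishes : shifted (suc q) ≡ 0ℚ
      top-vanishes = trans (cong (λ n → ℕ→ℚ n * y ^ suc q) (n<k⇒stirling≡0 (ℕₚ.n<1+n (suc q)))) (*-zeroˡ (y ^ suc q))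

  -- x(x+1)⋯(x+q) = Σ_k [q+1, k] x^k, divided by x.
  rising≡stirlingPoly : ∀ q y → rising q y ≡ stirlingPoly q y
  rising≡stirlingPoly zero    y = refl
  rising≡stirlingPoly (suc q) y = trans (cong (_* (y + ℕ→ℚ (suc q))) (rising≡stirlingPoly q y)) (sym (stirlingPoly-suc q y))

  rising-suc : ∀ q y → rising (suc q) y ≡ (y + 1ℚ) * rising q (y + 1ℚ)
  rising-suc zero    y = *-comm 1ℚ (y + 1ℚ)
  rising-suc (suc q) y = begin
    rising (suc q) y * (y + ℕ→ℚ (suc (suc q)))                 ≡⟨ cong₂ _*_ (rising-suc q y) (cong (_+_ y) (ℕ→ℚ-suc (suc q))) ⟩
    (y + 1ℚ) * rising q (y + 1ℚ) * (y + (1ℚ + ℕ→ℚ (suc q)))    ≡⟨ solve 4 (λ y o r c → (y :+ o) :* r :* (y :+ (o :+ c)) := (y :+ o) :* (r :* (y :+ o :+ c))) refl y 1ℚ (rising q (y + 1ℚ)) (ℕ→ℚ (suc q)) ⟩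
    (y + 1ℚ) * rising (suc q) (y + 1ℚ)                         ∎
    where open ≡-Reasoning

  rising-diff : ∀ q y → rising (suc q) (y + 1ℚ) ≡ rising (suc q) y + ℕ→ℚ (suc q) * rising q (y + 1ℚ)
  rising-diff q y = begin
    rising q (y + 1ℚ) * (y + 1ℚ + ℕ→ℚ (suc q))                   ≡⟨ solve 3 (λ r z c → r :* (z :+ c) := z :* r :+ c :* r) refl (rising q (y + 1ℚ)) (y + 1ℚ) (ℕ→ℚ (suc q)) ⟩
    (y + 1ℚ) * rising q (y + 1ℚ) + ℕ→ℚ (suc q) * rising q (y + 1ℚ) ≡⟨ cong (_+ ℕ→ℚ (suc q) * rising q (y + 1ℚ)) (sym (rising-suc q y)) ⟩
    rising (suc q) y + ℕ→ℚ (suc q) * rising q (y + 1ℚ)            ∎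
    where open ≡-Reasoning

  -- Repeated summation

  iteratedSum : ℕ → (ℕ → ℚ) → ℕ → ℚ
  iteratedSum zero    a   = a
  iteratedSum (suc r) a n = sum1 n (iteratedSum r a)

  HH≡iteratedSum : ∀ p r n → HH p r n ≡ iteratedSum r (invPow (+ p)) n
  HH≡iteratedSum p zero    n = refl
  HH≡iteratedSum p (suc r) n = sum1-cong n (λ i → HH≡iteratedSum p r (suc i))

  risingConvolution : ℕ → (ℕ → ℚ) → ℕ → ℚ
  risingConvolution q a n = sum1 n (λ j → rising q (ℕ→ℚ n - ℕ→ℚ j) * a j)

  risingConvolution-suc : ∀ q a n →
    risingConvolution (suc q) a (suc n) ≡ risingConvolution (suc q) a n + ℕ→ℚ (suc q) * risingConvolution q a (suc n)
  risingConvolution-suc q a n = begin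
    sum1 n (λ j → rising (suc q) (N′ - ℕ→ℚ j) * a j) + rising (suc q) (N′ - N′) * a (suc n)
      ≡⟨ cong₂ _+_ (sum1-cong n (λ j → interior (suc j))) lastTerm ⟩
    sum1 n (λ j → rising (suc q) (N - ℕ→ℚ j) * a j + c * lower j) + c * lower (suc n)
      ≡⟨ cong (_+ c * lower (suc n)) (sum1-distrib-+ n (λ j → rising (suc q) (N - ℕ→ℚ j) * a j) (λ j → c * lower j)) ⟩
    risingConvolution (suc q) a n + sum1 n (λ j → c * lower j) + c * lower (suc n)
      ≡⟨ cong (λ s → risingConvolution (suc q) a n + s + c * lower (suc n)) (sym (*-distribˡ-sum1 n c lower)) ⟩
    risingConvolution (suc q) a n + c * sum1 n lower + c * lower (suc n)
      ≡⟨ +-assoc (risingConvolution (suc q) a n) (c * sum1 n lower) (c * lower (suc n)) ⟩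
    risingConvolution (suc q) a n + (c * sum1 n lower + c * lower (suc n))
      ≡⟨ cong (_+_ (risingConvolution (suc q) a n)) (sym (*-distribˡ-+ c (sum1 n lower) (lower (suc n)))) ⟩
    risingConvolution (suc q) a n + c * risingConvolution q a (suc n) ∎
    where
      open ≡-Reasoning
      c = ℕ→ℚ (suc q)
      N = ℕ→ℚ n
      N′ = ℕ→ℚ (suc n)
      lower : ℕ → ℚ
      lower j = rising q (N′ - ℕ→ℚ j) * a j
      interior : ∀ j → rising (suc q) (N′ - ℕ→ℚ j) * a j ≡ rising (suc q) (N - ℕ→ℚ j) * a j + c * lower j
      interior j = begin
        rising (suc q) (N′ - ℕ→ℚ j) * a j                                  ≡⟨ cong (λ z → rising (suc q) z * a j) shift ⟩
        rising (suc q) (y + 1ℚ) * a j                                      ≡⟨ cong (_* a j) (rising-diff q y) ⟩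
        (rising (suc q) y + c * rising q (y + 1ℚ)) * a j                   ≡⟨ cong (λ z → (rising (suc q) y + c * rising q z) * a j) (sym shift) ⟩
        (rising (suc q) y + c * rising q (N′ - ℕ→ℚ j)) * a j               ≡⟨ solve 4 (λ s c r x → (s :+ c :* r) :* x := s :* x :+ c :* (r :* x))
                                                                                      refl (rising (suc q) y) c (rising q (N′ - ℕ→ℚ j)) (a j) ⟩
        rising (suc q) y * a j + c * lower j                               ∎
        where
          y = N - ℕ→ℚ j
          shift : N′ - ℕ→ℚ j ≡ y + 1ℚ
          shift = trans (cong (_- ℕ→ℚ j) (ℕ→ℚ-suc n)) (solve 2 (λ n j → con 1ℚ :+ n :- j := n :- j :+ con 1ℚ) refl N (ℕ→ℚ j))
      lastTerm : rising (suc q) (N′ - N′) * a (suc n) ≡ c * lower (suc n)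
      lastTerm = begin
        rising q z * (z + c) * a (suc n)    ≡⟨ cong (λ w → rising q z * (w + c) * a (suc n)) (+-inverseʳ N′) ⟩
        rising q z * (0ℚ + c) * a (suc n)   ≡⟨ solve 3 (λ r c x → r :* (con 0ℚ :+ c) :* x := c :* (r :* x)) refl (rising q z) c (a (suc n)) ⟩
        c * (rising q z * a (suc n))        ∎
        where z = N′ - N′

  q!*iteratedSum : ∀ q a n → ℕ→ℚ (q !) * iteratedSum (suc q) a n ≡ risingConvolution q a n
  q!*iteratedSum zero    a n       = *-distribˡ-sum1 n 1ℚ a
  q!*iteratedSum (suc q) a zero    = *-zeroʳ (ℕ→ℚ (suc q !))
  q!*iteratedSum (suc q) a (suc n) = begin
    ℕ→ℚ (suc q ℕ.* q !) * (A + B)              ≡⟨ cong (_* (A + B)) (ℕ→ℚ-homo-* (suc q) (q !)) ⟩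
    c * ℕ→ℚ (q !) * (A + B)                    ≡⟨ solve 4 (λ c f a b → c :* f :* (a :+ b) := c :* f :* a :+ c :* (f :* b)) refl c (ℕ→ℚ (q !)) A B ⟩
    c * ℕ→ℚ (q !) * A + c * (ℕ→ℚ (q !) * B)    ≡⟨ cong₂ (λ s t → s * A + c * t) (sym (ℕ→ℚ-homo-* (suc q) (q !))) (q!*iteratedSum q a (suc n)) ⟩
    ℕ→ℚ (suc q !) * A + c * risingConvolution q a (suc n)
                                               ≡⟨ cong (_+ c * risingConvolution q a (suc n)) (q!*iteratedSum (suc q) a n) ⟩
    risingConvolution (suc q) a n + c * risingConvolution q a (suc n)
                                               ≡⟨ sym (risingConvolution-suc q a n) ⟩
    risingConvolution (suc q) a (suc n)        ∎
    where
      open ≡-Reasoning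
      c = ℕ→ℚ (suc q)
      A = iteratedSum (suc (suc q)) a n
      B = iteratedSum (suc q) a (suc n)

  1/q! : ℕ → ℚ
  1/q! q = _/_ (+ 1) (q !) {{q ℕₚ.!≢0}}

  iteratedSum≡1/q!*risingConvolution : ∀ q a n → iteratedSum (suc q) a n ≡ 1/q! q * risingConvolution q a n
  iteratedSum≡1/q!*risingConvolution q a n = begin
    I                                   ≡⟨ sym (*-identityˡ I) ⟩
    1ℚ * I                              ≡⟨ cong (_* I) (sym (1/d*d≡1 (q !) {{q ℕₚ.!≢0}})) ⟩
    1/q! q * ℕ→ℚ (q !) * I              ≡⟨ *-assoc (1/q! q) (ℕ→ℚ (q !)) I ⟩
    1/q! q * (ℕ→ℚ (q !) * I)            ≡⟨ cong (1/q! q *_) (q!*iteratedSum q a n) ⟩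
    1/q! q * risingConvolution q a n    ∎
    where
      open ≡-Reasoning
      I = iteratedSum (suc q) a n

  -^≡sign*^ : ∀ y k → (- y) ^ k ≡ sign k * y ^ k
  -^≡sign*^ y zero    = sym (*-identityˡ 1ℚ)
  -^≡sign*^ y (suc k) = trans (cong (- y *_) (-^≡sign*^ y k))
    (solve 3 (λ y s p → (:- y) :* (s :* p) := (:- s) :* (y :* p)) refl y (sign k) (y ^ k))

  eulerCoefficient : ℕ → ℕ → ℕ → ℚ
  eulerCoefficient q m k = sign k * ℕ→ℚ (stirling (suc q) (suc m) ℕ.* (m C k))

  rising-expansion : ∀ q x y →
    rising q (x - y) ≡ triangleSum q (λ m k → eulerCoefficient q m k * (y ^ k * x ^ (m ℕ.∸ k)))
  rising-expansion q x y = trans (rising≡stirlingPoly q (x - y)) (sum0-cong q (λ m _ → term m))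
    where
      open ≡-Reasoning
      term : ∀ m → ℕ→ℚ (stirling (suc q) (suc m)) * (x - y) ^ m
                   ≡ sum0 m (λ k → eulerCoefficient q m k * (y ^ k * x ^ (m ℕ.∸ k)))
      term m = begin
        s * (x - y) ^ m                                                  ≡⟨ cong (λ z → s * z ^ m) (+-comm x (- y)) ⟩
        s * (- y + x) ^ m                                                ≡⟨ cong (s *_) (binomial m (- y) x) ⟩
        s * sum0 m (λ k → ℕ→ℚ (m C k) * ((- y) ^ k * x ^ (m ℕ.∸ k)))    ≡⟨ *-distribˡ-sum0 m s _ ⟩
        sum0 m (λ k → s * (ℕ→ℚ (m C k) * ((- y) ^ k * x ^ (m ℕ.∸ k))))  ≡⟨ sum0-cong m (λ k _ → regroup k) ⟩
        sum0 m (λ k → eulerCoefficient q m k * (y ^ k * x ^ (m ℕ.∸ k))) ∎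
        where
          s = ℕ→ℚ (stirling (suc q) (suc m))
          regroup : ∀ k → s * (ℕ→ℚ (m C k) * ((- y) ^ k * x ^ (m ℕ.∸ k))) ≡ eulerCoefficient q m k * (y ^ k * x ^ (m ℕ.∸ k))
          regroup k = begin
            s * (ℕ→ℚ (m C k) * ((- y) ^ k * x ^ (m ℕ.∸ k)))            ≡⟨ cong (λ z → s * (ℕ→ℚ (m C k) * (z * x ^ (m ℕ.∸ k)))) (-^≡sign*^ y k) ⟩
            s * (ℕ→ℚ (m C k) * (sign k * y ^ k * x ^ (m ℕ.∸ k)))        ≡⟨ solve 5 (λ s b σ a c → s :* (b :* (σ :* a :* c)) := σ :* (s :* b) :* (a :* c)) refl s (ℕ→ℚ (m C k)) (sign k) (y ^ k) (x ^ (m ℕ.∸ k)) ⟩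
            sign k * (s * ℕ→ℚ (m C k)) * (y ^ k * x ^ (m ℕ.∸ k))        ≡⟨ cong (λ z → sign k * z * (y ^ k * x ^ (m ℕ.∸ k))) (sym (ℕ→ℚ-homo-* (stirling (suc q) (suc m)) (m C k))) ⟩
            eulerCoefficient q m k * (y ^ k * x ^ (m ℕ.∸ k))           ∎

  r∸[m∸k]≡r+k∸m : ∀ r {m k} → k ℕ.≤ m → r ℕ.∸ (m ℕ.∸ k) ≡ r ℕ.+ k ℕ.∸ m
  r∸[m∸k]≡r+k∸m r {m} {k} k≤m = sym (begin
    r ℕ.+ k ℕ.∸ m                       ≡⟨ cong (r ℕ.+ k ℕ.∸_) (sym (ℕₚ.m+[n∸m]≡n k≤m)) ⟩
    r ℕ.+ k ℕ.∸ (k ℕ.+ (m ℕ.∸ k))       ≡⟨ sym (ℕₚ.∸-+-assoc (r ℕ.+ k) k (m ℕ.∸ k)) ⟩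
    r ℕ.+ k ℕ.∸ k ℕ.∸ (m ℕ.∸ k)         ≡⟨ cong (ℕ._∸ (m ℕ.∸ k)) (ℕₚ.m+n∸n≡m r k) ⟩
    r ℕ.∸ (m ℕ.∸ k)                     ∎)
    where open ≡-Reasoning

  HH*invPow≡triangleSum : ∀ p q r i → q ℕ.≤ r →
    HH p (suc q) (suc i) * invPow (+ r) (suc i)
      ≡ 1/q! q * triangleSum q (λ m k → eulerCoefficient q m k * (H (+ p ℤ.- + k) (suc i) * invPow (+ (r ℕ.+ k ℕ.∸ m)) (suc i)))
  HH*invPow≡triangleSum p q r i q≤r = begin
    HH p (suc q) n * u                             ≡⟨ cong (_* u) (trans (HH≡iteratedSum p (suc q) n) (iteratedSum≡1/q!*risingConvolution q w n)) ⟩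
    1/q! q * risingConvolution q w n * u           ≡⟨ *-assoc (1/q! q) (risingConvolution q w n) u ⟩
    1/q! q * (risingConvolution q w n * u)         ≡⟨ cong (1/q! q *_) convolution ⟩
    1/q! q * triangleSum q (λ m k → c m k * (H (+ p ℤ.- + k) n * invPow (+ (r ℕ.+ k ℕ.∸ m)) n)) ∎
    where
      open ≡-Reasoning
      n = suc i
      ι = ℕ→ℚ n
      u = invPow (+ r) n
      w = invPow (+ p)
      c = eulerCoefficient q
      term : ℕ → ℕ → ℕ → ℚ
      term j m k = c m k * (w j * ℕ→ℚ j ^ k * (ι ^ (m ℕ.∸ k) * u))

      summand : ∀ j → rising q (ι - ℕ→ℚ j) * w j * u ≡ triangleSum q (term j)
      summand j = begin
        rising q (ι - ℕ→ℚ j) * w j * u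
          ≡⟨ trans (*-assoc (rising q (ι - ℕ→ℚ j)) (w j) u) (cong (_* (w j * u)) (rising-expansion q ι (ℕ→ℚ j))) ⟩
        triangleSum q (λ m k → c m k * (ℕ→ℚ j ^ k * ι ^ (m ℕ.∸ k))) * (w j * u)
          ≡⟨ *-distribʳ-triangleSum q (w j * u) (λ m k → c m k * (ℕ→ℚ j ^ k * ι ^ (m ℕ.∸ k))) ⟩
        triangleSum q (λ m k → c m k * (ℕ→ℚ j ^ k * ι ^ (m ℕ.∸ k)) * (w j * u))
          ≡⟨ triangleSum-cong q (λ m k _ _ → solve 5 (λ c a b w u → c :* (a :* b) :* (w :* u) := c :* (w :* a :* (b :* u)))
                                                      refl (c m k) (ℕ→ℚ j ^ k) (ι ^ (m ℕ.∸ k)) (w j) u) ⟩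
        triangleSum q (term j) ∎

      inner : ∀ m k → m ℕ.≤ q → k ℕ.≤ m →
        sum1 n (λ j → term j m k) ≡ c m k * (H (+ p ℤ.- + k) n * invPow (+ (r ℕ.+ k ℕ.∸ m)) n)
      inner m k m≤q k≤m = begin
        sum1 n (λ j → term j m k)                                       ≡⟨ sym (*-distribˡ-sum1 n (c m k) (λ j → w j * ℕ→ℚ j ^ k * (ι ^ (m ℕ.∸ k) * u))) ⟩
        c m k * sum1 n (λ j → w j * ℕ→ℚ j ^ k * (ι ^ (m ℕ.∸ k) * u))   ≡⟨ cong (c m k *_) (sym (*-distribʳ-sum1 n (ι ^ (m ℕ.∸ k) * u) (λ j → w j * ℕ→ℚ j ^ k))) ⟩
        c m k * (sum1 n (λ j → w j * ℕ→ℚ j ^ k) * (ι ^ (m ℕ.∸ k) * u))  ≡⟨ cong₂ (λ a b → c m k * (a * b)) harmonic exponent ⟩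
        c m k * (H (+ p ℤ.- + k) n * invPow (+ (r ℕ.+ k ℕ.∸ m)) n)      ∎
        where
          harmonic : sum1 n (λ j → w j * ℕ→ℚ j ^ k) ≡ H (+ p ℤ.- + k) n
          harmonic = sum1-cong n (λ j → sym (invPow-minus (+ p) k j))
          exponent : ι ^ (m ℕ.∸ k) * u ≡ invPow (+ (r ℕ.+ k ℕ.∸ m)) n
          exponent = trans (ℕ→ℚ^*invPow i (ℕₚ.≤-trans (ℕₚ.m∸n≤m m k) (ℕₚ.≤-trans m≤q q≤r)))
                           (cong (λ e → invPow (+ e) n) (r∸[m∸k]≡r+k∸m r k≤m))

      convolution : risingConvolution q w n * u ≡ triangleSum q (λ m k → c m k * (H (+ p ℤ.- + k) n * invPow (+ (r ℕ.+ k ℕ.∸ m)) n))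
      convolution = begin
        risingConvolution q w n * u                                 ≡⟨ *-distribʳ-sum1 n u (λ j → rising q (ι - ℕ→ℚ j) * w j) ⟩
        sum1 n (λ j → rising q (ι - ℕ→ℚ j) * w j * u)               ≡⟨ sum1-cong n (λ j → summand (suc j)) ⟩
        sum1 n (λ j → triangleSum q (term j))                       ≡⟨ sum1-triangleSum-comm n q term ⟩
        triangleSum q (λ m k → sum1 n (λ j → term j m k))           ≡⟨ triangleSum-cong q inner ⟩
        triangleSum q (λ m k → c m k * (H (+ p ℤ.- + k) n * invPow (+ (r ℕ.+ k ℕ.∸ m)) n)) ∎

  zetaHHPartial≡rhsPartial : ∀ p q r N → q ℕ.≤ r → zetaHHPartial p (suc q) r N ≡ rhsPartial p q r N
  zetaHHPartial≡rhsPartial p q r N q≤r = begin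
    sum1 N (λ n → HH p (suc q) n * invPow (+ r) n)              ≡⟨ sum1-cong N (λ i → HH*invPow≡triangleSum p q r i q≤r) ⟩
    sum1 N (λ n → 1/q! q * triangleSum q (F n))                 ≡⟨ sym (*-distribˡ-sum1 N (1/q! q) (λ n → triangleSum q (F n))) ⟩
    1/q! q * sum1 N (λ n → triangleSum q (F n))                 ≡⟨ cong (1/q! q *_) (sum1-triangleSum-comm N q F) ⟩
    1/q! q * triangleSum q (λ m k → sum1 N (λ n → F n m k))     ≡⟨ cong (1/q! q *_) (triangleSum-cong q (λ m k _ _ → sym (*-distribˡ-sum1 N (c m k) (g m k)))) ⟩
    rhsPartial p q r N                                          ∎
    where
      open ≡-Reasoning
      c = eulerCoefficient q
      g : ℕ → ℕ → ℕ → ℚ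
      g m k n = H (+ p ℤ.- + k) n * invPow (+ (r ℕ.+ k ℕ.∸ m)) n
      F : ℕ → ℕ → ℕ → ℚ
      F n m k = c m k * g m k n

  ℕ→ℚ-mono-≤ : ∀ {m n} → m ℕ.≤ n → ℕ→ℚ m ≤ ℕ→ℚ n
  ℕ→ℚ-mono-≤ {m} {n} m≤n = subst₂ _≤_ (sym (ℕ→ℚ≡mkℚ m)) (sym (ℕ→ℚ≡mkℚ n))
    (ℚ.*≤* (subst₂ ℤ._≤_ (sym (ℤₚ.*-identityʳ (+ m))) (sym (ℤₚ.*-identityʳ (+ n))) (ℤ.+≤+ m≤n)))

  0≤ℕ→ℚ : ∀ n → 0ℚ ≤ ℕ→ℚ n
  0≤ℕ→ℚ n = ℕ→ℚ-mono-≤ {0} {n} z≤n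

  *-nonNeg : ∀ {p q} → 0ℚ ≤ p → 0ℚ ≤ q → 0ℚ ≤ p * q
  *-nonNeg {p} {q} 0≤p 0≤q = nonNegative⁻¹ (p * q) {{nonNeg*nonNeg⇒nonNeg p {{ℚ.nonNegative 0≤p}} q {{ℚ.nonNegative 0≤q}}}}

  *-mono-≤-nonNeg : ∀ {p q r s} → 0ℚ ≤ p → 0ℚ ≤ r → p ≤ q → r ≤ s → p * r ≤ q * s
  *-mono-≤-nonNeg {p} {q} {r} {s} 0≤p 0≤r p≤q r≤s = ≤-trans (*-monoʳ-≤-nonNeg r {{ℚ.nonNegative 0≤r}} p≤q)
                                                            (*-monoˡ-≤-nonNeg q {{ℚ.nonNegative (≤-trans 0≤p p≤q)}} r≤s)

  p≤p+q : ∀ {p q} → 0ℚ ≤ q → p ≤ p + q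
  p≤p+q {p} {q} 0≤q = subst (_≤ p + q) (+-identityʳ p) (+-monoʳ-≤ p 0≤q)

  p-q≤p : ∀ {p q} → 0ℚ ≤ q → p - q ≤ p
  p-q≤p {p} {q} 0≤q = subst (p - q ≤_) (+-identityʳ p) (+-monoʳ-≤ p (neg-antimono-≤ 0≤q))

  p≤q⇒0≤q-p : ∀ {p q} → p ≤ q → 0ℚ ≤ q - p
  p≤q⇒0≤q-p {p} {q} p≤q = subst (_≤ q - p) (+-inverseʳ p) (+-monoˡ-≤ (- p) p≤q)

  0≤q-p⇒p≤q : ∀ {p q} → 0ℚ ≤ q - p → p ≤ q
  0≤q-p⇒p≤q {p} {q} 0≤q-p = subst₂ _≤_ (+-identityʳ p) (solve 2 (λ p q → p :+ (q :- p) := q) refl p q) (+-monoʳ-≤ p 0≤q-p)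

  ∣p-q∣≡∣q-p∣ : ∀ p q → ∣ p - q ∣ ≡ ∣ q - p ∣
  ∣p-q∣≡∣q-p∣ p q = trans (cong ∣_∣ (solve 2 (λ p q → p :- q := :- (q :- p)) refl p q)) (∣-p∣≡∣p∣ (q - p))

  recip≡mkℚ : ∀ k → recip k ≡ mkℚ (+ 1) k (1-coprimeTo (suc k))
  recip≡mkℚ k = ↥p/↧p≡p (mkℚ (+ 1) k (1-coprimeTo (suc k)))

  0≤recip : ∀ k → 0ℚ ≤ recip k
  0≤recip k = subst (0ℚ ≤_) (sym (recip≡mkℚ k)) (ℚ.*≤* (ℤ.+≤+ z≤n))

  recip-antimono-≤ : ∀ {j k} → j ℕ.≤ k → recip k ≤ recip j
  recip-antimono-≤ {j} {k} j≤k = subst₂ _≤_ (sym (recip≡mkℚ k)) (sym (recip≡mkℚ j))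
    (ℚ.*≤* (subst₂ ℤ._≤_ (sym (ℤₚ.*-identityˡ (+ suc j))) (sym (ℤₚ.*-identityˡ (+ suc k))) (ℤ.+≤+ (s≤s j≤k))))

  recip≤1 : ∀ k → recip k ≤ 1ℚ
  recip≤1 k = recip-antimono-≤ {0} {k} z≤n

  0≤1 : 0ℚ ≤ 1ℚ
  0≤1 = ℚ.*≤* (ℤ.+≤+ z≤n)

  0≤^ : ∀ {x} n → 0ℚ ≤ x → 0ℚ ≤ x ^ n
  0≤^ zero    0≤x = 0≤1
  0≤^ (suc n) 0≤x = *-nonNeg 0≤x (0≤^ n 0≤x)

  ^-monoˡ-≤ : ∀ {x y} n → 0ℚ ≤ x → x ≤ y → x ^ n ≤ y ^ n
  ^-monoˡ-≤ zero    0≤x x≤y = ≤-refl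
  ^-monoˡ-≤ (suc n) 0≤x x≤y = *-mono-≤-nonNeg 0≤x (0≤^ n 0≤x) x≤y (^-monoˡ-≤ n 0≤x x≤y)

  ^-antimonoʳ-≤ : ∀ {x a b} → 0ℚ ≤ x → x ≤ 1ℚ → a ℕ.≤ b → x ^ b ≤ x ^ a
  ^-antimonoʳ-≤ {x} {a} {b} 0≤x x≤1 a≤b = begin
    x ^ b                       ≡⟨ cong (x ^_) (sym (ℕₚ.m∸n+n≡m a≤b)) ⟩
    x ^ (b ℕ.∸ a ℕ.+ a)         ≡⟨ ^-homo-* x (b ℕ.∸ a) a ⟩
    x ^ (b ℕ.∸ a) * x ^ a       ≤⟨ *-monoʳ-≤-nonNeg (x ^ a) {{ℚ.nonNegative (0≤^ a 0≤x)}} (subst (x ^ (b ℕ.∸ a) ≤_) (1^n≡1 (b ℕ.∸ a)) (^-monoˡ-≤ (b ℕ.∸ a) 0≤x x≤1)) ⟩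
    1ℚ * x ^ a                  ≡⟨ *-identityˡ (x ^ a) ⟩
    x ^ a                       ∎
    where open ≤-Reasoning

  0≤invPow : ∀ e n → 0ℚ ≤ invPow e n
  0≤invPow e        zero    = ≤-refl
  0≤invPow (+ e)    (suc k) = subst (0ℚ ≤_) (sym (invPow-+ e k)) (0≤^ e (0≤recip k))
  0≤invPow -[1+ e ] (suc k) = subst (0ℚ ≤_) (sym (invPow-neg e k)) (0≤^ (suc e) (0≤ℕ→ℚ (suc k)))

  invPow-antimono-≤ : ∀ {a b} k → a ℕ.≤ b → invPow (+ b) (suc k) ≤ invPow (+ a) (suc k)
  invPow-antimono-≤ {a} {b} k a≤b = subst₂ _≤_ (sym (invPow-+ b k)) (sym (invPow-+ a k)) (^-antimonoʳ-≤ (0≤recip k) (recip≤1 k) a≤b)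

  sum1-nonNeg : ∀ n {f : ℕ → ℚ} → (∀ i → 0ℚ ≤ f (suc i)) → 0ℚ ≤ sum1 n f
  sum1-nonNeg zero    0≤f = ≤-refl
  sum1-nonNeg (suc n) 0≤f = +-mono-≤ (sum1-nonNeg n 0≤f) (0≤f n)

  sum1-mono-≤ : ∀ n {f g : ℕ → ℚ} → (∀ i → f (suc i) ≤ g (suc i)) → sum1 n f ≤ sum1 n g
  sum1-mono-≤ zero    f≤g = ≤-refl
  sum1-mono-≤ (suc n) f≤g = +-mono-≤ (sum1-mono-≤ n f≤g) (f≤g n)

  sum1-monoʳ-≤ : ∀ {f : ℕ → ℚ} → (∀ i → 0ℚ ≤ f (suc i)) → ∀ {m n} → m ℕ.≤ n → sum1 m f ≤ sum1 n f
  sum1-monoʳ-≤ {f} 0≤f m≤n = go (ℕₚ.≤⇒≤′ m≤n)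
    where
      go : ∀ {m n} → m ℕ.≤′ n → sum1 m f ≤ sum1 n f
      go (ℕ.≤′-reflexive refl) = ≤-refl
      go (ℕ.≤′-step m≤′n)      = ≤-trans (go m≤′n) (p≤p+q (0≤f _))

  sum1≤n*c : ∀ n {f : ℕ → ℚ} c → (∀ i → i ℕ.< n → f (suc i) ≤ c) → sum1 n f ≤ ℕ→ℚ n * c
  sum1≤n*c zero    c f≤c = ≤-reflexive (sym (*-zeroˡ c))
  sum1≤n*c (suc n) {f} c f≤c = begin
    sum1 n f + f (suc n)        ≤⟨ +-mono-≤ (sum1≤n*c n c (λ i i<n → f≤c i (ℕₚ.m<n⇒m<1+n i<n))) (f≤c n ℕₚ.≤-refl) ⟩
    ℕ→ℚ n * c + c               ≡⟨ solve 2 (λ n c → n :* c :+ c := (con 1ℚ :+ n) :* c) refl (ℕ→ℚ n) c ⟩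
    (1ℚ + ℕ→ℚ n) * c            ≡⟨ cong (_* c) (sym (ℕ→ℚ-suc n)) ⟩
    ℕ→ℚ (suc n) * c             ∎
    where open ≤-Reasoning

  0≤H : ∀ e n → 0ℚ ≤ H e n
  0≤H e n = sum1-nonNeg n (λ i → 0≤invPow e (suc i))

  0≤HH : ∀ p q n → 0ℚ ≤ HH p q n
  0≤HH p zero    n = 0≤invPow (+ p) n
  0≤HH p (suc q) n = sum1-nonNeg n (λ i → 0≤HH p q (suc i))

  H-≤-H1 : ∀ {e} n → 1 ℕ.≤ e → H (+ e) n ≤ H (+ 1) n
  H-≤-H1 {e} n 1≤e = sum1-mono-≤ n (λ j → subst₂ _≤_ (sym (invPow-+ e j)) (sym (invPow-+ 1 j))
    (^-antimonoʳ-≤ (0≤recip j) (recip≤1 j) 1≤e))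

  1≤H1 : ∀ n → 1ℚ ≤ H (+ 1) (suc n)
  1≤H1 n = sum1-monoʳ-≤ (λ i → 0≤invPow (+ 1) (suc i)) (s≤s (z≤n {n}))

  HH≤ℕ→ℚ^*H1 : ∀ {p} q n → 1 ℕ.≤ p → HH p (suc q) (suc n) ≤ ℕ→ℚ (suc n) ^ q * H (+ 1) (suc n)
  HH≤ℕ→ℚ^*H1 {p} zero    n 1≤p = subst (H (+ p) (suc n) ≤_) (sym (*-identityˡ _)) (H-≤-H1 (suc n) 1≤p)
  HH≤ℕ→ℚ^*H1 {p} (suc q) n 1≤p = begin
    sum1 (suc n) (HH p (suc q))                              ≤⟨ sum1≤n*c (suc n) (HH p (suc q) (suc n)) (λ i i<n → sum1-monoʳ-≤ (λ j → 0≤HH p q (suc j)) i<n) ⟩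
    ℕ→ℚ (suc n) * HH p (suc q) (suc n)                       ≤⟨ *-monoˡ-≤-nonNeg (ℕ→ℚ (suc n)) {{ℚ.nonNegative (0≤ℕ→ℚ (suc n))}} (HH≤ℕ→ℚ^*H1 q n 1≤p) ⟩
    ℕ→ℚ (suc n) * (ℕ→ℚ (suc n) ^ q * H (+ 1) (suc n))        ≡⟨ sym (*-assoc (ℕ→ℚ (suc n)) (ℕ→ℚ (suc n) ^ q) (H (+ 1) (suc n))) ⟩
    ℕ→ℚ (suc n) ^ suc q * H (+ 1) (suc n)                    ∎
    where open ≤-Reasoning

  H-neg≤ℕ→ℚ^*H1 : ∀ t n → H (ℤ.- + t) (suc n) ≤ ℕ→ℚ (suc n) ^ suc t * H (+ 1) (suc n)
  H-neg≤ℕ→ℚ^*H1 t n = begin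
    H (ℤ.- + t) (suc n)                       ≤⟨ sum1≤n*c (suc n) (ι ^ t) term≤ ⟩
    ι * ι ^ t                                 ≡⟨ sym (*-identityʳ (ι ^ suc t)) ⟩
    ι ^ suc t * 1ℚ                            ≤⟨ *-monoˡ-≤-nonNeg (ι ^ suc t) {{ℚ.nonNegative (0≤^ (suc t) (0≤ℕ→ℚ (suc n)))}} (1≤H1 n) ⟩
    ι ^ suc t * H (+ 1) (suc n)               ∎
    where
      open ≤-Reasoning
      ι = ℕ→ℚ (suc n)
      term≤ : ∀ i → i ℕ.< suc n → invPow (ℤ.- + t) (suc i) ≤ ι ^ t
      term≤ i i<n = begin
        invPow (ℤ.- + t) (suc i)              ≡⟨ cong (λ e → invPow e (suc i)) (sym (ℤₚ.+-identityˡ (ℤ.- + t))) ⟩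
        invPow (+ 0 ℤ.- + t) (suc i)          ≡⟨ trans (invPow-minus (+ 0) t i) (*-identityˡ (ℕ→ℚ (suc i) ^ t)) ⟩
        ℕ→ℚ (suc i) ^ t                       ≤⟨ ^-monoˡ-≤ t (0≤ℕ→ℚ (suc i)) (ℕ→ℚ-mono-≤ i<n) ⟩
        ι ^ t                                 ∎

  H[p-k]≤ℕ→ℚ^*H1 : ∀ p k n → H (+ p ℤ.- + k) (suc n) ≤ ℕ→ℚ (suc n) ^ (suc k ℕ.∸ p) * H (+ 1) (suc n)
  H[p-k]≤ℕ→ℚ^*H1 p k n with k ℕ.<? p
  ... | yes k<p rewrite trans (ℤₚ.m-n≡m⊖n p k) (ℤₚ.⊖-≥ (ℕₚ.<⇒≤ k<p)) | ℕₚ.m≤n⇒m∸n≡0 k<p =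
    subst (H (+ (p ℕ.∸ k)) (suc n) ≤_) (sym (*-identityˡ _)) (H-≤-H1 (suc n) (ℕₚ.m<n⇒0<n∸m k<p))
  ... | no k≮p rewrite trans (ℤₚ.m-n≡m⊖n p k) (ℤₚ.⊖-≤ (ℕₚ.≮⇒≥ k≮p)) | ℕₚ.+-∸-assoc 1 (ℕₚ.≮⇒≥ k≮p) =
    H-neg≤ℕ→ℚ^*H1 (k ℕ.∸ p) n

  -- Convergence by comparison with Σ H_n / n^2

  sum1-telescoping-≤ : ∀ {a G : ℕ → ℚ} {n m} → (∀ i → n ℕ.≤ i → a (suc i) ≤ G i - G (suc i)) → n ℕ.≤ m →
    sum1 m a - sum1 n a ≤ G n - G m
  sum1-telescoping-≤ {a} {G} {n} a≤ΔG n≤m = go (ℕₚ.≤⇒≤′ n≤m)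
    where
      open ≤-Reasoning
      go : ∀ {m} → n ℕ.≤′ m → sum1 m a - sum1 n a ≤ G n - G m
      go (ℕ.≤′-reflexive refl) = ≤-reflexive (trans (+-inverseʳ (sum1 n a)) (sym (+-inverseʳ (G n))))
      go {suc m} (ℕ.≤′-step n≤′m) = begin
        sum1 m a + a (suc m) - sum1 n a    ≡⟨ solve 3 (λ s x t → s :+ x :- t := (s :- t) :+ x) refl (sum1 m a) (a (suc m)) (sum1 n a) ⟩
        (sum1 m a - sum1 n a) + a (suc m)  ≤⟨ +-mono-≤ (go n≤′m) (a≤ΔG m (ℕₚ.≤′⇒≤ n≤′m)) ⟩
        (G n - G m) + (G m - G (suc m))    ≡⟨ solve 3 (λ x y z → (x :- y) :+ (y :- z) := x :- z) refl (G n) (G m) (G (suc m)) ⟩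
        G n - G (suc m)                    ∎

  Cauchy-sum1-with-telescopingMajorant : ∀ {a G : ℕ → ℚ} →
    (∀ i → 0ℚ ≤ a (suc i)) → (∀ i → 1 ℕ.≤ i → a (suc i) ≤ G i - G (suc i)) → (∀ i → 0ℚ ≤ G i) →
    (∀ ε → 0ℚ < ε → Σ ℕ λ K → G (suc K) < ε) → Cauchy (λ N → sum1 N a)
  Cauchy-sum1-with-telescopingMajorant {a} {G} 0≤a a≤ΔG 0≤G G→0 ε 0<ε with G→0 ε 0<ε
  ... | K , G[1+K]<ε = suc K , λ m n K<m K<n → ≤-<-trans (bound m n K<m K<n) G[1+K]<ε
    where
      open ≤-Reasoning
      S : ℕ → ℚ
      S N = sum1 N a
      ordered : ∀ {m n} → suc K ℕ.≤ n → n ℕ.≤ m → ∣ S m - S n ∣ ≤ G (suc K)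
      ordered {m} {n} K<n n≤m = begin
        ∣ S m - S n ∣        ≡⟨ 0≤p⇒∣p∣≡p (p≤q⇒0≤q-p (sum1-monoʳ-≤ 0≤a n≤m)) ⟩
        S m - S n            ≤⟨ +-monoʳ-≤ (S m) (neg-antimono-≤ (sum1-monoʳ-≤ 0≤a K<n)) ⟩
        S m - S (suc K)      ≤⟨ sum1-telescoping-≤ {a} {G} (λ i K<i → a≤ΔG i (ℕₚ.≤-trans (s≤s z≤n) K<i)) (ℕₚ.≤-trans K<n n≤m) ⟩
        G (suc K) - G m      ≤⟨ p-q≤p (0≤G m) ⟩
        G (suc K)            ∎
      bound : ∀ m n → suc K ℕ.≤ m → suc K ℕ.≤ n → ∣ S m - S n ∣ ≤ G (suc K)
      bound m n K<m K<n with ℕₚ.≤-total n m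
      ... | inj₁ n≤m = ordered K<n n≤m
      ... | inj₂ m≤n = subst (_≤ G (suc K)) (∣p-q∣≡∣q-p∣ (S n) (S m)) (ordered K<m m≤n)

  harmonicSquareTerm : ℕ → ℚ
  harmonicSquareTerm n = H (+ 1) n * invPow (+ 2) n

  -- Bounds the tail of Σ harmonicSquareTerm beyond n (harmonicSquareTerm≤Δ telescopes).
  harmonicSquareTailBound : ℕ → ℚ
  harmonicSquareTailBound n = (H (+ 1) n + 1ℚ) * invPow (+ 1) n

  0≤harmonicSquareTailBound : ∀ n → 0ℚ ≤ harmonicSquareTailBound n
  0≤harmonicSquareTailBound n = *-nonNeg (+-mono-≤ (0≤H (+ 1) n) 0≤1) (0≤invPow (+ 1) n)

  harmonicSquareTerm≤Δ : ∀ n → 1 ℕ.≤ n →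
    harmonicSquareTerm (suc n) ≤ harmonicSquareTailBound n - harmonicSquareTailBound (suc n)
  harmonicSquareTerm≤Δ (suc k) _ = 0≤q-p⇒p≤q (subst (0ℚ ≤_) (sym gap)
    (*-nonNeg (*-nonNeg (+-mono-≤ (0≤H (+ 1) (suc k)) 0≤u) (*-nonNeg 0≤u 0≤u)) (0≤recip k)))
    where
      open ≡-Reasoning
      x = H (+ 1) (suc k)
      v = recip k
      u = recip (suc k)
      0≤u = 0≤recip (suc k)
      u′ = invPow (+ 1) (suc (suc k))
      gap : harmonicSquareTailBound (suc k) - harmonicSquareTailBound (suc (suc k)) - harmonicSquareTerm (suc (suc k))
            ≡ (x + u) * (u * u) * v
      gap = begin
        (x + 1ℚ) * invPow (+ 1) (suc k) - (x + u′ + 1ℚ) * u′ - (x + u′) * invPow (+ 2) (suc (suc k))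
          ≡⟨ cong₂ (λ a b → (x + 1ℚ) * a - (x + b + 1ℚ) * b - (x + b) * invPow (+ 2) (suc (suc k))) (invPow-1 k) (invPow-1 (suc k)) ⟩
        (x + 1ℚ) * v - (x + u + 1ℚ) * u - (x + u) * invPow (+ 2) (suc (suc k))
          ≡⟨ cong (λ w → (x + 1ℚ) * v - (x + u + 1ℚ) * u - (x + u) * w) (invPow-2 (suc k)) ⟩
        (x + 1ℚ) * v - (x + u + 1ℚ) * u - (x + u) * (u * u)
          -- the only relation needed between u = 1/(k+2) and v = 1/(k+1) is v - u = uv
          ≡⟨ solve 3 (λ x u v → (x :+ con 1ℚ) :* v :- (x :+ u :+ con 1ℚ) :* u :- (x :+ u) :* (u :* u)
                              := (x :+ u) :* (u :* u) :* v :+ (x :* (con 1ℚ :+ u) :+ con 1ℚ :+ u :+ u :* u) :* (v :- u :- u :* v))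
                     refl x u v ⟩
        (x + u) * (u * u) * v + (x * (1ℚ + u) + 1ℚ + u + u * u) * (v - u - u * v)
          ≡⟨ cong (λ z → (x + u) * (u * u) * v + (x * (1ℚ + u) + 1ℚ + u + u * u) * z) v-u-uv≡0 ⟩
        (x + u) * (u * u) * v + (x * (1ℚ + u) + 1ℚ + u + u * u) * 0ℚ
          ≡⟨ trans (cong (_+_ ((x + u) * (u * u) * v)) (*-zeroʳ (x * (1ℚ + u) + 1ℚ + u + u * u))) (+-identityʳ ((x + u) * (u * u) * v)) ⟩
        (x + u) * (u * u) * v ∎
        where
          v-u-uv≡0 : v - u - u * v ≡ 0ℚ
          v-u-uv≡0 = trans (cong (_- u * v) (recip-sub-recip-suc k)) (+-inverseʳ (u * v))

  H1≤ℕ→ℚ : ∀ n → H (+ 1) n ≤ ℕ→ℚ n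
  H1≤ℕ→ℚ n = subst (H (+ 1) n ≤_) (*-identityʳ (ℕ→ℚ n))
    (sum1≤n*c n 1ℚ (λ i _ → subst (_≤ 1ℚ) (sym (invPow-1 i)) (recip≤1 i)))

  H1≤K+N*recipK : ∀ {K N} → K ℕ.≤ N → H (+ 1) N ≤ ℕ→ℚ K + ℕ→ℚ N * recip K
  H1≤K+N*recipK {K} K≤N = go (ℕₚ.≤⇒≤′ K≤N)
    where
      open ≤-Reasoning
      go : ∀ {N} → K ℕ.≤′ N → H (+ 1) N ≤ ℕ→ℚ K + ℕ→ℚ N * recip K
      go (ℕ.≤′-reflexive refl) = ≤-trans (H1≤ℕ→ℚ K) (p≤p+q (*-nonNeg (0≤ℕ→ℚ K) (0≤recip K)))
      go {suc N} (ℕ.≤′-step K≤′N) = begin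
        H (+ 1) N + invPow (+ 1) (suc N)              ≤⟨ +-mono-≤ (go K≤′N) (subst (_≤ recip K) (sym (invPow-1 N)) (recip-antimono-≤ (ℕₚ.≤′⇒≤ K≤′N))) ⟩
        ℕ→ℚ K + ℕ→ℚ N * recip K + recip K            ≡⟨ solve 3 (λ k n r → k :+ n :* r :+ r := k :+ (con 1ℚ :+ n) :* r) refl (ℕ→ℚ K) (ℕ→ℚ N) (recip K) ⟩
        ℕ→ℚ K + (1ℚ + ℕ→ℚ N) * recip K               ≡⟨ cong (λ z → ℕ→ℚ K + z * recip K) (sym (ℕ→ℚ-suc N)) ⟩
        ℕ→ℚ K + ℕ→ℚ (suc N) * recip K                ∎

  harmonicSquareTailBound-square≤ : ∀ K → harmonicSquareTailBound (suc K ℕ.* suc K) ≤ recip K + recip K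
  harmonicSquareTailBound-square≤ K = begin
    (H (+ 1) N + 1ℚ) * invPow (+ 1) N                ≡⟨ cong ((H (+ 1) N + 1ℚ) *_) (trans (invPow-1 (K ℕ.+ K ℕ.* suc K)) 1/N≡r*r) ⟩
    (H (+ 1) N + 1ℚ) * (r * r)                        ≤⟨ *-monoʳ-≤-nonNeg (r * r) {{ℚ.nonNegative (*-nonNeg (0≤recip K) (0≤recip K))}}
                                                           (+-monoˡ-≤ 1ℚ (H1≤K+N*recipK (ℕₚ.m≤n⇒m≤1+n (ℕₚ.m≤m+n K (K ℕ.* suc K))))) ⟩
    (ℕ→ℚ K + ℕ→ℚ N * r + 1ℚ) * (r * r)               ≡⟨ cong (λ z → (ℕ→ℚ K + z * r + 1ℚ) * (r * r)) (ℕ→ℚ-homo-* (suc K) (suc K)) ⟩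
    (ℕ→ℚ K + M * M * r + 1ℚ) * (r * r)               ≡⟨ solve 3 (λ k m r → (k :+ m :* m :* r :+ con 1ℚ) :* (r :* r) := (k :+ con 1ℚ) :* r :* r :+ (m :* r) :* (m :* r) :* r) refl (ℕ→ℚ K) M r ⟩
    (ℕ→ℚ K + 1ℚ) * r * r + (M * r) * (M * r) * r     ≡⟨ cong₂ (λ a b → a * r + b * b * r) [K+1]*r≡1 M*r≡1 ⟩
    1ℚ * r + 1ℚ * 1ℚ * r                              ≡⟨ solve 1 (λ r → con 1ℚ :* r :+ con 1ℚ :* con 1ℚ :* r := r :+ r) refl r ⟩
    r + r                                             ∎
    where
      open ≤-Reasoning
      N = suc K ℕ.* suc K
      M = ℕ→ℚ (suc K)
      r = recip K
      M*r≡1 : M * r ≡ 1ℚ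
      M*r≡1 = trans (*-comm M r) (recip*ℕ→ℚ≡1 K)
      [K+1]*r≡1 : (ℕ→ℚ K + 1ℚ) * r ≡ 1ℚ
      [K+1]*r≡1 = trans (cong (_* r) (trans (+-comm (ℕ→ℚ K) 1ℚ) (sym (ℕ→ℚ-suc K)))) M*r≡1
      1/N≡r*r : recip (K ℕ.+ K ℕ.* suc K) ≡ r * r
      1/N≡r*r = sym (*ℕ→ℚ≡1⇒≡1/ N (r * r) (begin-equality
        r * r * ℕ→ℚ N      ≡⟨ cong (r * r *_) (ℕ→ℚ-homo-* (suc K) (suc K)) ⟩
        r * r * (M * M)    ≡⟨ solve 2 (λ r m → r :* r :* (m :* m) := (m :* r) :* (m :* r)) refl r M ⟩
        (M * r) * (M * r)  ≡⟨ cong₂ _*_ M*r≡1 M*r≡1 ⟩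
        1ℚ                 ∎))

  recip<ε : ∀ ε → 0ℚ < ε → Σ ℕ λ k → recip k < ε
  recip<ε (mkℚ (+ zero) _ _) (ℚ.*<* (ℤ.+<+ ()))
  recip<ε (mkℚ -[1+ _ ] _ _) (ℚ.*<* ())
  recip<ε ε@(mkℚ (+ suc n) d _) _ = suc d , subst (_< ε) (sym (recip≡mkℚ (suc d)))
    (ℚ.*<* (subst₂ ℤ._<_ (sym (ℤₚ.*-identityˡ (+ suc d))) (ℤₚ.pos-* (suc n) (suc (suc d))) (ℤ.+<+ (ℕₚ.m≤n*m (suc (suc d)) (suc n)))))

  harmonicSquareTailBound→0 : ∀ ε → 0ℚ < ε → Σ ℕ λ K → harmonicSquareTailBound (suc K) < ε
  harmonicSquareTailBound→0 ε 0<ε with recip<ε ε 0<ε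
  ... | k , recip[k]<ε = K ℕ.+ K ℕ.* suc K , ≤-<-trans (harmonicSquareTailBound-square≤ K) (subst (_< ε) (sym (recip+recip≡recip k)) recip[k]<ε)
    where K = k ℕ.+ suc k

  term≤harmonicSquareTerm : ∀ {t s} i X → 0ℚ ≤ X → X ≤ ℕ→ℚ (suc i) ^ t * H (+ 1) (suc i) → 2 ℕ.+ t ℕ.≤ s →
    X * invPow (+ s) (suc i) ≤ harmonicSquareTerm (suc i)
  term≤harmonicSquareTerm {t} {s} i X 0≤X X≤ 2+t≤s = begin
    X * invPow (+ s) n                                ≤⟨ *-monoʳ-≤-nonNeg (invPow (+ s) n) {{ℚ.nonNegative (0≤invPow (+ s) n)}} X≤ ⟩
    ℕ→ℚ n ^ t * H (+ 1) n * invPow (+ s) n            ≡⟨ solve 3 (λ a h u → a :* h :* u := h :* (a :* u)) refl (ℕ→ℚ n ^ t) (H (+ 1) n) (invPow (+ s) n) ⟩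
    H (+ 1) n * (ℕ→ℚ n ^ t * invPow (+ s) n)          ≡⟨ cong (H (+ 1) n *_) (ℕ→ℚ^*invPow i (ℕₚ.m+n≤o⇒n≤o 2 2+t≤s)) ⟩
    H (+ 1) n * invPow (+ (s ℕ.∸ t)) n                ≤⟨ *-monoˡ-≤-nonNeg (H (+ 1) n) {{ℚ.nonNegative (0≤H (+ 1) n)}} (invPow-antimono-≤ i (ℕₚ.m+n≤o⇒m≤o∸n 2 2+t≤s)) ⟩
    H (+ 1) n * invPow (+ 2) n                        ∎
    where
      open ≤-Reasoning
      n = suc i

  zetaPartial-Cauchy : ∀ {t s} (X : ℕ → ℚ) → (∀ i → 0ℚ ≤ X (suc i)) →
    (∀ i → X (suc i) ≤ ℕ→ℚ (suc i) ^ t * H (+ 1) (suc i)) → 2 ℕ.+ t ℕ.≤ s → Cauchy (zetaPartial X s)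
  zetaPartial-Cauchy {s = s} X 0≤X X≤ 2+t≤s = Cauchy-sum1-with-telescopingMajorant
    (λ i → *-nonNeg (0≤X i) (0≤invPow (+ s) (suc i)))
    (λ i 1≤i → ≤-trans (term≤harmonicSquareTerm i (X (suc i)) (0≤X i) (X≤ i) 2+t≤s) (harmonicSquareTerm≤Δ i 1≤i))
    0≤harmonicSquareTailBound
    harmonicSquareTailBound→0

  ≗⇒SameLimit : ∀ {f g : ℕ → ℚ} → (∀ n → f n ≡ g n) → SameLimit f g
  ≗⇒SameLimit {f} {g} f≗g ε 0<ε = 0 , λ n _ → subst (_< ε) (sym (trans (cong (λ z → ∣ z - g n ∣) (f≗g n)) (cong ∣_∣ (+-inverseʳ (g n))))) 0<ε

open EulerSums using (zetaPartial-Cauchy; 0≤HH; HH≤ℕ→ℚ^*H1; 0≤H; H[p-k]≤ℕ→ℚ^*H1; ≗⇒SameLimit; zetaHHPartial≡rhsPartial)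

open import Data.Nat using (ℕ; suc; _≤_; _<_; _+_; _∸_)
open import Data.Integer using (+_; _-_)
open import Data.Product using (_×_; _,_)
import Data.Nat.Properties as ℕₚ
open import Relation.Binary.PropositionalEquality using (subst; cong)

theorem2 : (p q r : ℕ) → 1 ≤ p → 1 ≤ q → suc q < r →
    Cauchy (zetaHHPartial p (suc q) r)
    × (∀ m k → m ≤ q → k ≤ m → Cauchy (zetaHPartial (+ p - + k) (r + k ∸ m)))
    × SameLimit (zetaHHPartial p (suc q) r) (rhsPartial p q r)
theorem2 p q r 1≤p _ 2+q≤r =
    zetaPartial-Cauchy (HH p (suc q)) (λ i → 0≤HH p (suc q) (suc i)) (λ i → HH≤ℕ→ℚ^*H1 q i 1≤p) 2+q≤r
  , (λ m k m≤q _ → zetaPartial-Cauchy (H (+ p - + k)) (λ i → 0≤H (+ p - + k) (suc i)) (H[p-k]≤ℕ→ℚ^*H1 p k)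
                                       (exponent-gap m k m≤q))
  , ≗⇒SameLimit (λ N → zetaHHPartial≡rhsPartial p q r N (ℕₚ.m+n≤o⇒n≤o 2 2+q≤r))
  where
    exponent-gap : ∀ m k → m ≤ q → 2 + (suc k ∸ p) ≤ r + k ∸ m
    exponent-gap m k m≤q = ℕₚ.≤-trans (ℕₚ.+-monoʳ-≤ 2 (ℕₚ.∸-monoʳ-≤ (suc k) 1≤p))
      (ℕₚ.m+n≤o⇒m≤o∸n (2 + k) (subst (_≤ r + k) (cong (λ z → 2 + z) (ℕₚ.+-comm m k))
        (ℕₚ.+-monoˡ-≤ k (ℕₚ.≤-trans (ℕₚ.+-monoʳ-≤ 2 m≤q) 2+q≤r))))
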